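{- Let $k\geq 3$ be an integer. Every extremal square-free word on a $k$-letter alphabet has length greater than $$\left(\frac{5}{4}\right)^{k/4}.$$
   Context: A word is a finite sequence of letters from an alphabet. A factor of a word $W$ is a word $U$ with $W=W_1UW_2$ for some (possibly empty) words $W_1,W_2$. A square is a nonempty word of the form $XX$; a word is square-free if none of its factors is a square. An extension of a word $W$ over an alphabet $\mathbb{A}$ is any word $W_1xW_2$ where $W=W_1W_2$ (with $W_1,W_2$ possibly empty) and $x\in\mathbb{A}$. A word $W$ over $\mathbb{A}$ is extremal square-free if $W$ is square-free and every extension of $W$ over $\mathbb{A}$ contains a square as a factor. -}

module Defs where

open import Data.Nat using (ℕ)
open import Data.Fin using (Fin)
open import Data.List using (List; []; _∷_; _++_; [_])
open import Data.Product using (∃-syntax; _×_)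
open import Relation.Binary.PropositionalEquality using (_≡_)
open import Relation.Nullary using (¬_)

Word : Set → Set
Word A = List A

Factor : {A : Set} → Word A → Word A → Set
Factor {A} U W = ∃[ W₁ ] ∃[ W₂ ] (W ≡ W₁ ++ U ++ W₂)

IsSquare : {A : Set} → Word A → Set
IsSquare {A} S = ∃[ X ] (¬ (X ≡ []) × S ≡ X ++ X)

HasSquare : {A : Set} → Word A → Set
HasSquare {A} W = ∃[ S ] (IsSquare S × Factor S W)

SquareFree : {A : Set} → Word A → Set
SquareFree W = ¬ HasSquare W

Extension : {A : Set} → Word A → Word A → Set
Extension {A} V W =
  ∃[ W₁ ] ∃[ W₂ ] ∃[ x ] (W ≡ W₁ ++ W₂ × V ≡ W₁ ++ [ x ] ++ W₂)

ExtremalSquareFree : {A : Set} → Word A → Set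
ExtremalSquareFree {A} W =
  SquareFree W × (∀ (V : Word A) → Extension V W → HasSquare V)

-- Prepending a letter x creates
-- a square, and as W itself is square-free that square is a prefix x Y x Y of
-- x W; write m x = |Y|.  The letter of W at position m x is x, so m is
-- injective, and m x < m y ≤ 2 m x is impossible because the two prefixes
-- would then overlap in a square inside W.  So the k values of m at least
-- double from one to the next, their ⌊log₂ (1 + m x)⌋ are distinct and at most
-- ⌊log₂ |W|⌋, and |W| ≥ 2^(k-1), far beyond (5/4)^(k/4).
module Submission where

open import Defs
open import Data.Nat
  using (ℕ; zero; suc; _+_; _*_; _^_; _≤_; _<_; z≤n; s≤s; z<s; _≤?_; NonZero; >-nonZero; ⌊_/2⌋; ⌈_/2⌉)
open import Data.Nat.Properties
open import Data.Nat.Logarithm using (⌊log₂_⌋; ⌊log₂⌋-mono-≤; ⌊log₂[2*b]⌋≡1+⌊log₂b⌋)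
open import Data.Nat.Logarithm.Core using (⌊log2⌋)
open import Data.Nat.Tactic.RingSolver using (solve-∀)
open import Data.Fin using (Fin; fromℕ<; toℕ)
open import Data.Fin.Properties using (injective⇒≤; toℕ-fromℕ<)
open import Data.List using (List; []; _∷_; _++_; [_]; length)
open import Data.List.Properties using (length-++; ++-assoc; ++-identityʳ; ++-conicalʳ; ∷-injective; ∷-injectiveˡ; ∷-injectiveʳ)
open import Data.Product using (∃-syntax; _×_; _,_)
open import Data.Empty using (⊥-elim)
open import Function.Definitions using (Injective)
open import Induction.WellFounded using (Acc; acc)
open import Relation.Nullary using (yes; no)
open import Relation.Binary.Definitions using (tri<; tri≈; tri>)
open import Relation.Binary.PropositionalEquality using (_≡_; _≢_; refl; sym; trans; cong; subst; module ≡-Reasoning)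

module _ {A : Set} where

  ++-split : (xs ys us vs : List A) → xs ++ ys ≡ us ++ vs → length xs ≤ length us →
             ∃[ zs ] (us ≡ xs ++ zs × ys ≡ zs ++ vs)
  ++-split []       ys us       vs eq _        = us , refl , eq
  ++-split (x ∷ xs) ys (_ ∷ us) vs eq (s≤s le) with refl , eq′ ← ∷-injective eq
    with zs , us≡ , ys≡ ← ++-split xs ys us vs eq′ le = zs , cong (x ∷_) us≡ , ys≡

  ++-∷-aligned : ∀ xs us {x u : A} {ys vs} → xs ++ x ∷ ys ≡ us ++ u ∷ vs →
                 length xs ≡ length us → x ≡ u
  ++-∷-aligned []       []       eq _ = ∷-injectiveˡ eq
  ++-∷-aligned (_ ∷ xs) (_ ∷ us) eq l = ++-∷-aligned xs us (∷-injectiveʳ eq) (suc-injective l)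

  -- x ∷ W = (x ∷ core) ++ (x ∷ core) ++ rest
  record SquarePrefix (x : A) (W : List A) : Set where
    constructor squarePrefix
    field
      core rest : List A
      shape     : W ≡ core ++ x ∷ core ++ rest

  open SquarePrefix

  squareFree⇒squarePrefix : ∀ {x W} → SquareFree W → HasSquare (x ∷ W) → SquarePrefix x W
  squareFree⇒squarePrefix _ (_ , ([] , X≢[] , refl) , [] , _ , _) = ⊥-elim (X≢[] refl)
  squareFree⇒squarePrefix _ (_ , (_ ∷ Y , _ , refl) , [] , rest , eq)
    with refl , W≡ ← ∷-injective eq = squarePrefix Y rest (trans W≡ (++-assoc Y _ rest))
  squareFree⇒squarePrefix sf (S , square , _ ∷ W₁ , W₂ , eq) =
    ⊥-elim (sf (S , square , W₁ , W₂ , ∷-injectiveʳ eq))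

  extremal⇒squarePrefix : ∀ {W} → ExtremalSquareFree W → (x : A) → SquarePrefix x W
  extremal⇒squarePrefix {W} (sf , ext) x =
    squareFree⇒squarePrefix sf (ext (x ∷ W) ([] , W , x , refl , refl))

  core<length : ∀ {x W} (p : SquarePrefix x W) → length (core p) < length W
  core<length {x} (squarePrefix Y V refl) = begin-strict
    length Y                       <⟨ m<m+n (length Y) z<s ⟩
    length Y + length (x ∷ Y ++ V) ≡⟨ length-++ Y ⟨
    length (Y ++ x ∷ Y ++ V)       ∎
    where open ≤-Reasoning

  squarePrefix-injective : ∀ {x y W} (p : SquarePrefix x W) (q : SquarePrefix y W) →
                           length (core p) ≡ length (core q) → x ≡ y
  squarePrefix-injective (squarePrefix Y _ eY) (squarePrefix Z _ eZ) =
    ++-∷-aligned Y Z (trans (sym eY) eZ)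

  -- With W = Y x Y V = Z y Z V' and Z = Y c R, the word R y is a prefix of Y
  -- (this is where |Z| ≤ 2|Y| is used), and W = (Y x) (R y) (R y) ….
  overlapping-squarePrefixes⇒square :
    ∀ {x y W} (p : SquarePrefix x W) (q : SquarePrefix y W) →
    length (core p) < length (core q) → length (core q) ≤ 2 * length (core p) → HasSquare W
  overlapping-squarePrefixes⇒square {x} {y} {W} (squarePrefix Y V eY) (squarePrefix Z V′ eZ) Y<Z Z≤2Y
    with ++-split Y _ Z _ (trans (sym eY) eZ) (<⇒≤ Y<Z)
  ... | [] , Z≡Y++[] , _ = ⊥-elim (<-irrefl (cong length (sym (trans Z≡Y++[] (++-identityʳ Y)))) Y<Z)
  ... | c ∷ R , Z≡ , xY≡ with ++-split (R ++ [ y ]) (Z ++ V′) Y V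
                                      (trans (++-assoc R _ _) (sym (∷-injectiveʳ xY≡))) Ry≤Y
    where
    Z-length : length Z ≡ length Y + suc (length R)
    Z-length = trans (cong length Z≡) (length-++ Y)
    Ry≤Y : length (R ++ [ y ]) ≤ length Y
    Ry≤Y = begin
      length (R ++ [ y ])   ≡⟨ trans (length-++ R) (+-comm (length R) 1) ⟩
      suc (length R)        ≤⟨ +-cancelˡ-≤ (length Y) _ _ (≤-trans (≤-reflexive (sym Z-length)) Z≤2Y) ⟩
      length Y + 0          ≡⟨ +-identityʳ (length Y) ⟩
      length Y              ∎
      where open ≤-Reasoning
  ... | B , Y≡ , ZV′≡ = Ry ++ Ry , (Ry , Ry≢[] , refl) , Y ++ [ x ] , tail , W≡
    where
    open ≡-Reasoning
    Ry   = R ++ [ y ]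
    tail = B ++ c ∷ R ++ V′
    Ry≢[] : Ry ≢ []
    Ry≢[] eq with () ← ++-conicalʳ R [ y ] eq
    BV≡ : B ++ V ≡ Ry ++ tail
    BV≡ = begin
      B ++ V                    ≡⟨ ZV′≡ ⟨
      Z ++ V′                   ≡⟨ cong (_++ V′) Z≡ ⟩
      (Y ++ c ∷ R) ++ V′        ≡⟨ ++-assoc Y _ V′ ⟩
      Y ++ c ∷ R ++ V′          ≡⟨ cong (_++ c ∷ R ++ V′) Y≡ ⟩
      (Ry ++ B) ++ c ∷ R ++ V′  ≡⟨ ++-assoc Ry B _ ⟩
      Ry ++ tail                ∎
    W≡ : W ≡ (Y ++ [ x ]) ++ (Ry ++ Ry) ++ tail
    W≡ = begin
      W                         ≡⟨ eY ⟩
      Y ++ x ∷ Y ++ V           ≡⟨ cong (λ T → Y ++ x ∷ T ++ V) Y≡ ⟩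
      Y ++ x ∷ (Ry ++ B) ++ V   ≡⟨ cong (λ T → Y ++ x ∷ T) (++-assoc Ry B V) ⟩
      Y ++ x ∷ Ry ++ B ++ V     ≡⟨ cong (λ T → Y ++ x ∷ Ry ++ T) BV≡ ⟩
      Y ++ x ∷ Ry ++ Ry ++ tail ≡⟨ cong (λ T → Y ++ x ∷ T) (++-assoc Ry Ry tail) ⟨
      Y ++ x ∷ (Ry ++ Ry) ++ tail ≡⟨ ++-assoc Y [ x ] _ ⟨
      (Y ++ [ x ]) ++ (Ry ++ Ry) ++ tail ∎

  squarePrefix-doubling : ∀ {x y W} → SquareFree W → (p : SquarePrefix x W) (q : SquarePrefix y W) →
                          length (core p) < length (core q) → 2 * length (core p) < length (core q)
  squarePrefix-doubling sf p q p<q with length (core q) ≤? 2 * length (core p)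
  ... | yes q≤2p = ⊥-elim (sf (overlapping-squarePrefixes⇒square p q p<q q≤2p))
  ... | no  q≰2p = ≰⇒> q≰2p

2^⌊log2⌋≤n : ∀ n (rec : Acc _<_ n) .{{_ : NonZero n}} → 2 ^ ⌊log2⌋ n rec ≤ n
2^⌊log2⌋≤n 1             _         = ≤-refl
2^⌊log2⌋≤n (suc (suc n)) (acc rec) = begin
  2 * 2 ^ ⌊log2⌋ (suc ⌊ n /2⌋) _ ≤⟨ *-monoʳ-≤ 2 (2^⌊log2⌋≤n (suc ⌊ n /2⌋) (rec _)) ⟩
  2 * suc ⌊ n /2⌋             ≡⟨ *-suc 2 ⌊ n /2⌋ ⟩
  2 + 2 * ⌊ n /2⌋             ≤⟨ +-monoʳ-≤ 2 2⌊n/2⌋≤n ⟩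
  2 + n                       ∎
  where
  open ≤-Reasoning
  2⌊n/2⌋≤n : 2 * ⌊ n /2⌋ ≤ n
  2⌊n/2⌋≤n = begin
    ⌊ n /2⌋ + (⌊ n /2⌋ + 0) ≡⟨ cong (⌊ n /2⌋ +_) (+-identityʳ _) ⟩
    ⌊ n /2⌋ + ⌊ n /2⌋       ≤⟨ +-monoʳ-≤ ⌊ n /2⌋ (⌊n/2⌋≤⌈n/2⌉ n) ⟩
    ⌊ n /2⌋ + ⌈ n /2⌉       ≡⟨ ⌊n/2⌋+⌈n/2⌉≡n n ⟩
    n                       ∎

2^⌊log₂n⌋≤n : ∀ n .{{_ : NonZero n}} → 2 ^ ⌊log₂ n ⌋ ≤ n
2^⌊log₂n⌋≤n n = 2^⌊log2⌋≤n n _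

doubling⇒≤1+⌊log₂⌋ : ∀ {k n} (m : Fin k → ℕ) → Injective _≡_ _≡_ m →
                     (∀ {x y} → m x < m y → 2 * m x < m y) → (∀ x → m x < n) →
                     k ≤ suc ⌊log₂ n ⌋
doubling⇒≤1+⌊log₂⌋ {k} {n} m m-injective m-doubling m<n = injective⇒≤ level-injective
  where
  lg : Fin k → ℕ
  lg x = ⌊log₂ suc (m x) ⌋

  lg-mono : ∀ {x y} → m x < m y → lg x < lg y
  lg-mono {x} {y} mx<my = begin-strict
    lg x                          <⟨ n<1+n (lg x) ⟩
    suc (lg x)                    ≡⟨ ⌊log₂[2*b]⌋≡1+⌊log₂b⌋ (suc (m x)) ⟨
    ⌊log₂ (2 * suc (m x)) ⌋       ≤⟨ ⌊log₂⌋-mono-≤ (subst (_≤ suc (m y)) (sym (*-suc 2 (m x)))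
                                                            (s≤s (m-doubling mx<my))) ⟩
    lg y                          ∎
    where open ≤-Reasoning

  lg-injective : ∀ {x y} → lg x ≡ lg y → x ≡ y
  lg-injective {x} {y} eq with <-cmp (m x) (m y)
  ... | tri< mx<my _ _ = ⊥-elim (<⇒≢ (lg-mono mx<my) eq)
  ... | tri≈ _ mx≡my _ = m-injective mx≡my
  ... | tri> _ _ my<mx = ⊥-elim (<⇒≢ (lg-mono my<mx) (sym eq))

  lg-bounded : ∀ x → lg x < suc ⌊log₂ n ⌋
  lg-bounded x = s≤s (⌊log₂⌋-mono-≤ (m<n x))

  level : Fin k → Fin (suc ⌊log₂ n ⌋)
  level x = fromℕ< (lg-bounded x)

  level-injective : Injective _≡_ _≡_ level
  level-injective {x} {y} eq = lg-injective (begin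
    lg x                    ≡⟨ toℕ-fromℕ< (lg-bounded x) ⟨
    toℕ (level x)           ≡⟨ cong toℕ eq ⟩
    toℕ (level y)           ≡⟨ toℕ-fromℕ< (lg-bounded y) ⟩
    lg y                    ∎)
    where open ≡-Reasoning

extremal⇒2^k≤length : ∀ {k} {W : List (Fin (suc k))} → ExtremalSquareFree W → 2 ^ k ≤ length W
extremal⇒2^k≤length {k} {W} extremal@(sf , _) = begin
  2 ^ k                  ≤⟨ ^-monoʳ-≤ 2 (≤-pred (doubling⇒≤1+⌊log₂⌋ m m-injective m-doubling m<length)) ⟩
  2 ^ ⌊log₂ length W ⌋   ≤⟨ 2^⌊log₂n⌋≤n (length W) {{>-nonZero (≤-trans z<s (m<length Data.Fin.zero))}} ⟩
  length W               ∎
  where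
  open ≤-Reasoning
  open SquarePrefix

  prefix : (x : Fin (suc k)) → SquarePrefix x W
  prefix = extremal⇒squarePrefix extremal

  m : Fin (suc k) → ℕ
  m x = length (core (prefix x))

  m-injective : Injective _≡_ _≡_ m
  m-injective = squarePrefix-injective (prefix _) (prefix _)

  m-doubling : ∀ {x y} → m x < m y → 2 * m x < m y
  m-doubling = squarePrefix-doubling sf (prefix _) (prefix _)

  m<length : ∀ x → m x < length W
  m<length x = core<length (prefix x)

5^[2+i]<4^[2+i]*2^[1+i] : ∀ i → 5 ^ (2 + i) < 4 ^ (2 + i) * 2 ^ (1 + i)
5^[2+i]<4^[2+i]*2^[1+i] zero    = m<m+n 25 {7} z<s
5^[2+i]<4^[2+i]*2^[1+i] (suc i) = begin-strict
  5 * 5 ^ (2 + i)                       <⟨ *-monoʳ-< 5 (5^[2+i]<4^[2+i]*2^[1+i] i) ⟩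
  5 * (4 ^ (2 + i) * 2 ^ (1 + i))       ≤⟨ *-monoˡ-≤ (4 ^ (2 + i) * 2 ^ (1 + i)) (m≤m+n 5 3) ⟩
  8 * (4 ^ (2 + i) * 2 ^ (1 + i))       ≡⟨ regroup (4 ^ (2 + i)) (2 ^ (1 + i)) ⟩
  4 * 4 ^ (2 + i) * (2 * 2 ^ (1 + i))   ∎
  where
  open ≤-Reasoning
  regroup : ∀ a b → 8 * (a * b) ≡ 4 * a * (2 * b)
  regroup = solve-∀

n≤n^[1+k] : ∀ n k → n ≤ n ^ suc k
n≤n^[1+k] zero    _ = z≤n
n≤n^[1+k] (suc n) k = m≤m*n (suc n) (suc n ^ k) {{m^n≢0 (suc n) k}}

theorem1p7 : (k : ℕ) → 3 ≤ k → (W : List (Fin k)) → ExtremalSquareFree W →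
    5 ^ k < 4 ^ k * length W ^ 4
theorem1p7 (suc (suc (suc i))) (s≤s (s≤s (s≤s _))) W extremal = begin-strict
  5 ^ (3 + i)                 <⟨ 5^[2+i]<4^[2+i]*2^[1+i] (suc i) ⟩
  4 ^ (3 + i) * 2 ^ (2 + i)   ≤⟨ *-monoʳ-≤ (4 ^ (3 + i)) (≤-trans (extremal⇒2^k≤length extremal)
                                                                  (n≤n^[1+k] (length W) 3)) ⟩
  4 ^ (3 + i) * length W ^ 4  ∎
  where open ≤-Reasoning
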